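{- Let $n$ be a positive integer and consider the random $1$-Naples parking model with $p=1/2$. Then $\alpha\in\{1,\ldots,n\}^n$ is a parking function if and only if $\mathbb{P}(\alpha\text{ parks})=1$.
   Context: Parking spots $1,\ldots,n$ in a line; cars $C_1,\ldots,C_n$ arrive in order, $C_i$ preferring spot $\alpha_i$; a car whose preferred spot is empty parks there. $\alpha$ is a parking function if all cars park when each car whose preferred spot $\alpha_i$ is occupied parks in the first empty spot among $\alpha_i+1,\ldots,n$ (failing if none). In the random $1$-Naples model with $p=1/2$, each car $C_i$ whose preferred spot is occupied independently, with probability $1/2$, parks at $\alpha_i-1$ if $\alpha_i\ge2$ and that spot is empty and otherwise in the first empty spot among $\alpha_i+1,\ldots,n$; and with probability $1/2$ parks in the first empty spot among $\alpha_i+1,\ldots,n$ (failing if no empty spot is found). $\alpha$ parks if every car parks. -}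

module Defs where

open import Data.Nat using (ℕ; zero; suc; _≤_; _∸_; _<ᵇ_; _≡ᵇ_)
open import Data.Bool using (Bool; true; false; if_then_else_; not; _∧_)
open import Data.Bool.ListAction using (any)
open import Data.List using (List; []; _∷_; filter; map; upTo; foldr)
open import Data.Maybe using (Maybe; just; nothing; is-just)
open import Data.Vec using (Vec; []; _∷_)
open import Data.Product using (_×_)
open import Data.Rational using (ℚ; 0ℚ; 1ℚ; ½; _+_; _*_; _-_)
open import Data.Vec.Relation.Unary.All using (All)

-- Spots are numbered 1..n.  A state is the list of occupied spots.
occupied : List ℕ → ℕ → Bool
occupied occ s = any (λ x → x ≡ᵇ s) occ

spotsAfter : ℕ → ℕ → List ℕ
spotsAfter a n = map (λ i → suc (a Data.Nat.+ i)) (upTo (n ∸ a))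

firstEmptyAfter : ℕ → List ℕ → ℕ → Maybe ℕ
firstEmptyAfter n occ a with filter (λ s → Data.Bool._≟_ (occupied occ s) false) (spotsAfter a n)
... | []    = nothing
... | s ∷ _ = just s

parkForward : ℕ → List ℕ → ℕ → Maybe (List ℕ)
parkForward n occ a with firstEmptyAfter n occ a
... | nothing = nothing
... | just s  = just (s ∷ occ)

stepPF : ℕ → List ℕ → ℕ → Maybe (List ℕ)
stepPF n occ a = if occupied occ a then parkForward n occ a else just (a ∷ occ)

-- random 1-Naples rule, one car with preference a and coin outcome b
-- (b = true: the event of probability p, try spot a-1 first)
stepNaples : ℕ → List ℕ → ℕ → Bool → Maybe (List ℕ)
stepNaples n occ a b =
  if occupied occ a
  then (if b ∧ (1 <ᵇ a) ∧ not (occupied occ (a ∸ 1))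
        then just ((a ∸ 1) ∷ occ)
        else parkForward n occ a)
  else just (a ∷ occ)

runPF : ℕ → List ℕ → ∀ {m} → Vec ℕ m → Maybe (List ℕ)
runPF n occ []      = just occ
runPF n occ (a ∷ α) with stepPF n occ a
... | nothing   = nothing
... | just occ' = runPF n occ' α

runNaples : ℕ → List ℕ → ∀ {m} → Vec ℕ m → Vec Bool m → Maybe (List ℕ)
runNaples n occ []      []      = just occ
runNaples n occ (a ∷ α) (b ∷ c) with stepNaples n occ a b
... | nothing   = nothing
... | just occ' = runNaples n occ' α c

IsParkingFunction : ∀ {n} → Vec ℕ n → Set
IsParkingFunction {n} α = is-just (runPF n [] α) ≡ true
  where open import Relation.Binary.PropositionalEquality using (_≡_)

allCoins : (m : ℕ) → List (Vec Bool m)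
allCoins zero    = [] ∷ []
allCoins (suc m) = map (true ∷_) (allCoins m) Data.List.++ map (false ∷_) (allCoins m)

coinWeight : ℚ → ∀ {m} → Vec Bool m → ℚ
coinWeight p []          = 1ℚ
coinWeight p (true ∷ c)  = p * coinWeight p c
coinWeight p (false ∷ c) = (1ℚ - p) * coinWeight p c

probParks : ℚ → ∀ {n} → Vec ℕ n → ℚ
probParks p {n} α =
  foldr (λ c acc → (if is-just (runNaples n [] α c) then coinWeight p c else 0ℚ) + acc)
        0ℚ (allCoins n)

InRange : ℕ → ℕ → Set
InRange n a = (1 ≤ a) × (a ≤ n)

-- A Naples car with preference a parks on an empty spot s ≤ n such that all of a, …, s − 1
-- are occupied (vacuously so after a backward move).  This is exactly what preserves the
-- classical invariant: every final segment j, …, n of the street has at least as many empty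
-- spots as there are remaining cars preferring a spot in it.  Under the invariant no car
-- can fail, and running the classical process shows that a parking function satisfies it at
-- the start; so a parking function parks for every coin sequence.  Conversely the all-false
-- coin sequence has positive weight and reproduces classical parking.
module Submission where

open import Defs
open import Data.Bool using (Bool; true; false; if_then_else_; not; _∧_; _≟_)
open import Data.Bool.Properties using (¬-not; T-≡)
open import Data.Empty using (⊥-elim)
open import Data.List using (List; []; _∷_; filter; map; applyUpTo; foldr; _++_)
open import Data.List.Properties using (map-applyUpTo)
open import Data.List.Membership.Propositional using (_∈_)
open import Data.List.Membership.Propositional.Properties using (∈-++⁺ˡ; ∈-++⁺ʳ; ∈-map⁺)
open import Data.List.Relation.Unary.Any using (here; there)
open import Data.Maybe using (just; nothing; is-just)
open import Data.Maybe.Properties using (just-injective)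
open import Data.Nat using (ℕ; zero; suc)
open import Data.Product using (∃-syntax; _×_; _,_)
open import Data.Rational using (ℚ; 1ℚ; ½)
open import Data.Sum using (inj₁; inj₂)
open import Data.Vec using (Vec; []; _∷_; count; replicate)
open import Data.Vec.Relation.Unary.All using (All; []; _∷_)
open import Function.Bundles using (_⇔_; mk⇔; Equivalence)
open import Relation.Binary.PropositionalEquality
  using (_≡_; _≢_; ≢-sym; refl; sym; trans; cong; cong₂; subst; module ≡-Reasoning)
open import Relation.Nullary using (¬_; Dec; yes; no)
open import Relation.Nullary.Decidable using (dec-true; dec-false)
open import Relation.Unary using (Decidable)

module Mass where
  open import Data.Rational using (0ℚ; _+_; _*_; _-_; -_; _<_; _≤_; _<?_; positive)
  open import Relation.Nullary.Decidable using (toWitness)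
  open import Data.Rational.Properties
    using (≤-refl; <⇒≤; <-irrefl; +-mono-≤; +-mono-<-≤; +-mono-≤-<; +-monoˡ-<; +-comm; +-assoc;
           +-identityˡ; +-identityʳ; +-inverseˡ; +-inverseʳ; *-zeroʳ; *-distribˡ-+;
           *-distribʳ-+; *-identityˡ; positive⁻¹; pos*pos⇒pos)
  open ≡-Reasoning

  module _ {A : Set} (w : A → ℚ) where

    mass : List A → ℚ
    mass = foldr (λ x acc → w x + acc) 0ℚ

    massOf : (A → Bool) → List A → ℚ
    massOf g = foldr (λ x acc → (if g x then w x else 0ℚ) + acc) 0ℚ

    mass-++ : ∀ xs ys → mass (xs ++ ys) ≡ mass xs + mass ys
    mass-++ []       ys = sym (+-identityˡ (mass ys))
    mass-++ (x ∷ xs) ys =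
      trans (cong (w x +_) (mass-++ xs ys)) (sym (+-assoc (w x) (mass xs) (mass ys)))

    massOf-all : ∀ g xs → (∀ x → g x ≡ true) → massOf g xs ≡ mass xs
    massOf-all g []       _   = refl
    massOf-all g (x ∷ xs) all rewrite all x = cong (w x +_) (massOf-all g xs all)

    module _ (w>0 : ∀ x → 0ℚ < w x) where

      massOf-term≤ : ∀ b x → (if b then w x else 0ℚ) ≤ w x
      massOf-term≤ true  x = ≤-refl
      massOf-term≤ false x = <⇒≤ (w>0 x)

      massOf-≤ : ∀ g xs → massOf g xs ≤ mass xs
      massOf-≤ g []       = ≤-refl
      massOf-≤ g (x ∷ xs) = +-mono-≤ (massOf-term≤ (g x) x) (massOf-≤ g xs)

      massOf-< : ∀ g {x} xs → x ∈ xs → g x ≡ false → massOf g xs < mass xs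
      massOf-< g (x ∷ xs) (here refl) gx rewrite gx = +-mono-<-≤ (w>0 x) (massOf-≤ g xs)
      massOf-< g (y ∷ xs) (there x∈xs) gx = +-mono-≤-< (massOf-term≤ (g y) y) (massOf-< g xs x∈xs gx)

      massOf≡mass⇒true : ∀ g {x} xs → massOf g xs ≡ mass xs → x ∈ xs → g x ≡ true
      massOf≡mass⇒true g {x} xs full x∈xs with g x in gx
      ... | true  = refl
      ... | false = ⊥-elim (<-irrefl full (massOf-< g xs x∈xs gx))

  mass-map : ∀ {A B : Set} (w : B → ℚ) (v : A → ℚ) (f : A → B) r →
             (∀ x → w (f x) ≡ r * v x) → ∀ xs → mass w (map f xs) ≡ r * mass v xs
  mass-map w v f r scale []       = sym (*-zeroʳ r)
  mass-map w v f r scale (x ∷ xs) =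
    trans (cong₂ _+_ (scale x) (mass-map w v f r scale xs)) (sym (*-distribˡ-+ r (v x) (mass v xs)))

  p+[1-p]≡1 : ∀ p → p + (1ℚ - p) ≡ 1ℚ
  p+[1-p]≡1 p = begin
    p + (1ℚ - p)     ≡⟨ +-comm p (1ℚ - p) ⟩
    1ℚ - p + p       ≡⟨ +-assoc 1ℚ (- p) p ⟩
    1ℚ + (- p + p)   ≡⟨ cong (1ℚ +_) (+-inverseˡ p) ⟩
    1ℚ + 0ℚ          ≡⟨ +-identityʳ 1ℚ ⟩
    1ℚ               ∎

  mass-allCoins : ∀ p m → mass (coinWeight p) (allCoins m) ≡ 1ℚ
  mass-allCoins p zero    = refl
  mass-allCoins p (suc m) = begin
    mass w (map (true ∷_) L ++ map (false ∷_) L)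
      ≡⟨ mass-++ w (map (true ∷_) L) _ ⟩
    mass w (map (true ∷_) L) + mass w (map (false ∷_) L)
      ≡⟨ cong₂ _+_ (mass-map w w (true ∷_) p (λ _ → refl) L)
                   (mass-map w w (false ∷_) (1ℚ - p) (λ _ → refl) L) ⟩
    p * mass w L + (1ℚ - p) * mass w L
      ≡⟨ sym (*-distribʳ-+ (mass w L) p (1ℚ - p)) ⟩
    (p + (1ℚ - p)) * mass w L
      ≡⟨ cong₂ _*_ (p+[1-p]≡1 p) (mass-allCoins p m) ⟩
    1ℚ * 1ℚ
      ≡⟨ *-identityˡ 1ℚ ⟩
    1ℚ ∎
    where
    w : ∀ {k} → Vec Bool k → ℚ
    w = coinWeight p
    L = allCoins m

  *-pos : ∀ {x y} → 0ℚ < x → 0ℚ < y → 0ℚ < x * y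
  *-pos {x} {y} 0<x 0<y = positive⁻¹ (x * y) {{pos*pos⇒pos x {{positive 0<x}} y {{positive 0<y}}}}

  coinWeight-pos : ∀ {p} → 0ℚ < p → p < 1ℚ → ∀ {m} (c : Vec Bool m) → 0ℚ < coinWeight p c
  coinWeight-pos         0<p p<1 []          = positive⁻¹ 1ℚ
  coinWeight-pos         0<p p<1 (true ∷ c)  = *-pos 0<p (coinWeight-pos 0<p p<1 c)
  coinWeight-pos {p = p} 0<p p<1 (false ∷ c) = *-pos 0<1-p (coinWeight-pos 0<p p<1 c)
    where
    0<1-p : 0ℚ < 1ℚ - p
    0<1-p = subst (_< 1ℚ - p) (+-inverseʳ p) (+-monoˡ-< (- p) p<1)

  0<½ : 0ℚ < ½
  0<½ = positive⁻¹ ½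

  ½<1 : ½ < 1ℚ
  ½<1 = toWitness {a? = ½ <? 1ℚ} _

  allCoins-complete : ∀ {m} (c : Vec Bool m) → c ∈ allCoins m
  allCoins-complete []          = here refl
  allCoins-complete (true ∷ c)  = ∈-++⁺ˡ (∈-map⁺ (true ∷_) (allCoins-complete c))
  allCoins-complete {suc m} (false ∷ c) =
    ∈-++⁺ʳ (map (true ∷_) (allCoins m)) (∈-map⁺ (false ∷_) (allCoins-complete c))

open Mass

open import Data.Nat using (_+_; _∸_; _≤_; _<_; z≤n; s≤s; _≤?_; _≡ᵇ_; _<ᵇ_)
open import Data.Nat.Properties
  using (≤-refl; ≤-reflexive; ≤-trans; <⇒≤; ≰⇒>; ≤⇒≯; <⇒≢; <-≤-trans; ≤-pred; n≤1+n;
         m<n⇒m<1+n; m<m+n; m≤m+n; m≤n⇒m<n∨m≡n; m≤n⇒∃[o]m+o≡n; m+[n∸m]≡n; m∸n≤m;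
         +-suc; +-assoc; +-identityʳ; +-mono-≤; +-monoʳ-≤; ≡ᵇ⇒≡; ≡⇒≡ᵇ; module ≤-Reasoning)
open ≤-Reasoning

≡ᵇ-refl : ∀ s → (s ≡ᵇ s) ≡ true
≡ᵇ-refl s = Equivalence.to T-≡ (≡⇒≡ᵇ s s refl)

≢⇒≡ᵇ-false : ∀ {s t} → s ≢ t → (s ≡ᵇ t) ≡ false
≢⇒≡ᵇ-false {s} {t} s≢t = ¬-not (λ s≡ᵇt → s≢t (≡ᵇ⇒≡ s t (Equivalence.from T-≡ s≡ᵇt)))

∧-not≡true : ∀ x y z → x ∧ y ∧ not z ≡ true → z ≡ false
∧-not≡true true  true  false _ = refl
∧-not≡true true  true  true  ()
∧-not≡true true  false _     ()
∧-not≡true false _     _     ()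

module _ {A : Set} {P : A → Set} (P? : Decidable P) where

  count-accept : ∀ {m x} (xs : Vec A m) → P x → count P? (x ∷ xs) ≡ suc (count P? xs)
  count-accept {x = x} xs px rewrite dec-true (P? x) px = refl

  count-reject : ∀ {m x} (xs : Vec A m) → ¬ P x → count P? (x ∷ xs) ≡ count P? xs
  count-reject {x = x} xs ¬px rewrite dec-false (P? x) ¬px = refl

  count-∷ : ∀ {m} x (xs : Vec A m) → count P? xs ≤ count P? (x ∷ xs)
  count-∷ x xs with P? x
  ... | yes px = n≤1+n _
  ... | no ¬px = ≤-refl

count-≤?-antitone : ∀ {m i j} (α : Vec ℕ m) → i ≤ j → count (j ≤?_) α ≤ count (i ≤?_) α
count-≤?-antitone [] i≤j = z≤n
count-≤?-antitone {i = i} {j} (a ∷ α) i≤j with j ≤? a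
... | yes j≤a = begin
  count (j ≤?_) (a ∷ α)  ≡⟨ count-accept (j ≤?_) α j≤a ⟩
  suc (count (j ≤?_) α)  ≤⟨ s≤s (count-≤?-antitone α i≤j) ⟩
  suc (count (i ≤?_) α)  ≡⟨ count-accept (i ≤?_) α (≤-trans i≤j j≤a) ⟨
  count (i ≤?_) (a ∷ α)  ∎
... | no j≰a = begin
  count (j ≤?_) (a ∷ α)  ≡⟨ count-reject (j ≤?_) α j≰a ⟩
  count (j ≤?_) α        ≤⟨ count-≤?-antitone α i≤j ⟩
  count (i ≤?_) α        ≤⟨ count-∷ (i ≤?_) a α ⟩
  count (i ≤?_) (a ∷ α)  ∎

Full : List ℕ → ℕ → ℕ → Set
Full occ lo hi = ∀ t → lo ≤ t → t < hi → occupied occ t ≡ true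

Full-empty : ∀ occ {lo hi} → hi ≤ lo → Full occ lo hi
Full-empty occ hi≤lo t lo≤t t<hi = ⊥-elim (≤⇒≯ lo≤t (<-≤-trans t<hi hi≤lo))

Full-extendˡ : ∀ occ {lo hi} → occupied occ lo ≡ true → Full occ (suc lo) hi → Full occ lo hi
Full-extendˡ occ occ-lo full t lo≤t t<hi with m≤n⇒m<n∨m≡n lo≤t
... | inj₁ lo<t = full t lo<t t<hi
... | inj₂ refl = occ-lo

Full-shrinkʳ : ∀ occ {lo hi hi′} → hi′ ≤ hi → Full occ lo hi → Full occ lo hi′
Full-shrinkʳ occ hi′≤hi full t lo≤t t<hi′ = full t lo≤t (<-≤-trans t<hi′ hi′≤hi)

emptySpots : List ℕ → ℕ → ℕ → ℕ
emptySpots occ j zero    = 0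
emptySpots occ j (suc k) = (if occupied occ j then 0 else 1) + emptySpots occ (suc j) k

emptySpots-park-below : ∀ {s} occ j k → s < j → emptySpots (s ∷ occ) j k ≡ emptySpots occ j k
emptySpots-park-below     occ j zero    s<j = refl
emptySpots-park-below {s} occ j (suc k) s<j rewrite ≢⇒≡ᵇ-false (<⇒≢ s<j) =
  cong (_ +_) (emptySpots-park-below occ (suc j) k (m<n⇒m<1+n s<j))

emptySpots-park-free : ∀ {s} occ j k → occupied occ s ≡ false → j ≤ s → s < j + k →
                       suc (emptySpots (s ∷ occ) j k) ≡ emptySpots occ j k
emptySpots-park-free occ j zero free j≤s s<j+0 =
  ⊥-elim (≤⇒≯ j≤s (subst (_ <_) (+-identityʳ j) s<j+0))
emptySpots-park-free {s} occ j (suc k) free j≤s s<j+k with m≤n⇒m<n∨m≡n j≤s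
... | inj₂ refl rewrite ≡ᵇ-refl s | free = cong suc (emptySpots-park-below occ (suc s) k ≤-refl)
... | inj₁ j<s rewrite ≢⇒≡ᵇ-false (≢-sym (<⇒≢ j<s)) = trans (sym (+-suc _ _)) (cong (_ +_)
  (emptySpots-park-free occ (suc j) k free j<s (subst (s <_) (+-suc j k) s<j+k)))

emptySpots-park-≤ : ∀ {s} occ j k → emptySpots (s ∷ occ) j k ≤ emptySpots occ j k
emptySpots-park-≤     occ j zero = z≤n
emptySpots-park-≤ {s} occ j (suc k) with s ≡ᵇ j
... | true  = +-mono-≤ z≤n (emptySpots-park-≤ occ (suc j) k)
... | false = +-monoʳ-≤ _ (emptySpots-park-≤ occ (suc j) k)

emptySpots-skipFull : ∀ occ a d k → Full occ a (a + d) →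
                      emptySpots occ a (d + k) ≡ emptySpots occ (a + d) k
emptySpots-skipFull occ a zero    k full rewrite +-identityʳ a = refl
emptySpots-skipFull occ a (suc d) k full rewrite full a ≤-refl (m<m+n a (s≤s z≤n)) | +-suc a d =
  emptySpots-skipFull occ (suc a) d k (λ t a<t t<a+d → full t (<⇒≤ a<t) t<a+d)

spotsFrom : ℕ → ℕ → List ℕ
spotsFrom lo zero    = []
spotsFrom lo (suc k) = lo ∷ spotsFrom (suc lo) k

applyUpTo≡spotsFrom : ∀ {f} lo k → (∀ i → f i ≡ lo + i) → applyUpTo f k ≡ spotsFrom lo k
applyUpTo≡spotsFrom lo zero    f≗ = refl
applyUpTo≡spotsFrom lo (suc k) f≗ =
  cong₂ _∷_ (trans (f≗ 0) (+-identityʳ lo))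
            (applyUpTo≡spotsFrom (suc lo) k (λ i → trans (f≗ (suc i)) (+-suc lo i)))

spotsAfter≡spotsFrom : ∀ a n → spotsAfter a n ≡ spotsFrom (suc a) (n ∸ a)
spotsAfter≡spotsFrom a n =
  trans (map-applyUpTo (λ i → i) (λ i → suc (a + i)) (n ∸ a))
        (applyUpTo≡spotsFrom (suc a) (n ∸ a) (λ _ → refl))

module _ (occ : List ℕ) where

  free? : (s : ℕ) → Dec (occupied occ s ≡ false)
  free? s = occupied occ s ≟ false

  filter-free-[] : ∀ lo k → filter free? (spotsFrom lo k) ≡ [] → Full occ lo (lo + k)
  filter-free-[] lo zero    _    = Full-empty occ (≤-reflexive (+-identityʳ lo))
  filter-free-[] lo (suc k) none with free? lo
  filter-free-[] lo (suc k) ()   | yes _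
  filter-free-[] lo (suc k) none | no ¬free = Full-extendˡ occ (¬-not ¬free)
    (subst (Full occ (suc lo)) (sym (+-suc lo k)) (filter-free-[] (suc lo) k none))

  filter-free-∷ : ∀ lo k {s r} → filter free? (spotsFrom lo k) ≡ s ∷ r →
                  lo ≤ s × s < lo + k × occupied occ s ≡ false × Full occ lo s
  filter-free-∷ lo (suc k) first with free? lo
  filter-free-∷ lo (suc k) refl | yes free =
    ≤-refl , m<m+n lo (s≤s z≤n) , free , Full-empty occ ≤-refl
  filter-free-∷ lo (suc k) {s} first | no ¬free with filter-free-∷ (suc lo) k first
  ... | lo<s , s<lo+k , free , full =
    <⇒≤ lo<s , subst (s <_) (sym (+-suc lo k)) s<lo+k , free , Full-extendˡ occ (¬-not ¬free) full

filter-free-spotsAfter : ∀ occ a n {xs} → filter (free? occ) (spotsAfter a n) ≡ xs →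
                  filter (free? occ) (spotsFrom (suc a) (n ∸ a)) ≡ xs
filter-free-spotsAfter occ a n = trans (cong (filter (free? occ)) (sym (spotsAfter≡spotsFrom a n)))

parkForward-nothing : ∀ {n occ a} → a ≤ n → parkForward n occ a ≡ nothing → Full occ (suc a) (suc n)
parkForward-nothing {n} {occ} {a} a≤n fails with filter (free? occ) (spotsAfter a n) in scan
... | [] = subst (Full occ (suc a)) (cong suc (m+[n∸m]≡n a≤n))
                 (filter-free-[] occ (suc a) (n ∸ a) (filter-free-spotsAfter occ a n scan))
parkForward-nothing a≤n () | _ ∷ _

parkForward-just : ∀ {n occ a occ'} → a ≤ n → parkForward n occ a ≡ just occ' →
  ∃[ s ] occ' ≡ s ∷ occ × a < s × s ≤ n × occupied occ s ≡ false × Full occ (suc a) s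
parkForward-just {n} {occ} {a} a≤n parks with filter (free? occ) (spotsAfter a n) in scan
parkForward-just a≤n () | []
parkForward-just {n} {occ} {a} a≤n refl | s ∷ _
  with filter-free-∷ occ (suc a) (n ∸ a) (filter-free-spotsAfter occ a n scan)
... | a<s , s<1+a+[n-a] , free , full =
  s , refl , a<s , ≤-pred (subst (s <_) (cong suc (m+[n∸m]≡n a≤n)) s<1+a+[n-a]) , free , full

stepPF-just : ∀ {n occ a occ'} → a ≤ n → stepPF n occ a ≡ just occ' →
  ∃[ s ] occ' ≡ s ∷ occ × a ≤ s × s ≤ n × occupied occ s ≡ false
stepPF-just {occ = occ} {a} a≤n parks with occupied occ a in occ-a
... | false = a , sym (just-injective parks) , ≤-refl , a≤n , occ-a
... | true with parkForward-just a≤n parks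
...   | s , occ'≡ , a<s , s≤n , free , _ = s , occ'≡ , <⇒≤ a<s , s≤n , free

module _ (n : ℕ) where

  -- The window j, …, j + k − 1 is the final segment j, …, n of the street.
  Feasible : ∀ {m} → List ℕ → Vec ℕ m → Set
  Feasible occ α = ∀ j k → j + k ≡ suc n → count (j ≤?_) α ≤ emptySpots occ j k

  s<j+k : ∀ {s} j k → j + k ≡ suc n → s ≤ n → s < j + k
  s<j+k {s} j k j+k≡1+n s≤n = subst (s <_) (sym j+k≡1+n) (s≤s s≤n)

  ValidSpot : List ℕ → ℕ → ℕ → Set
  ValidSpot occ a s = occupied occ s ≡ false × s ≤ n × Full occ a s

  Feasible⇒¬Full : ∀ {m occ a} {α : Vec ℕ m} → Feasible occ (a ∷ α) → a ≤ n → ¬ Full occ a (suc n)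
  Feasible⇒¬Full {occ = occ} {a} {α} feasible a≤n full
    with m≤n⇒∃[o]m+o≡n (≤-trans a≤n (n≤1+n n))
  ... | d , a+d≡1+n with () ← begin
    suc (count (a ≤?_) α)   ≡⟨ count-accept (a ≤?_) α ≤-refl ⟨
    count (a ≤?_) (a ∷ α)   ≤⟨ feasible a d a+d≡1+n ⟩
    emptySpots occ a d      ≡⟨ cong (emptySpots occ a) (+-identityʳ d) ⟨
    emptySpots occ a (d + 0) ≡⟨ emptySpots-skipFull occ a d 0 (subst (Full occ a) (sym a+d≡1+n) full) ⟩
    0                        ∎

  Feasible-park : ∀ {m occ a s} {α : Vec ℕ m} → ValidSpot occ a s →
                  Feasible occ (a ∷ α) → Feasible (s ∷ occ) α
  Feasible-park {occ = occ} {a} {s} {α} (free , s≤n , full) feasible j k j+k≡1+n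
    with j ≤? s
  ... | no j≰s = begin
    count (j ≤?_) α          ≤⟨ count-∷ (j ≤?_) a α ⟩
    count (j ≤?_) (a ∷ α)    ≤⟨ feasible j k j+k≡1+n ⟩
    emptySpots occ j k       ≡⟨ emptySpots-park-below occ j k (≰⇒> j≰s) ⟨
    emptySpots (s ∷ occ) j k ∎
  ... | yes j≤s = ≤-pred (begin
    suc (count (j ≤?_) α)          ≤⟨ carCounted ⟩
    emptySpots occ j k             ≡⟨ emptySpots-park-free occ j k free j≤s (s<j+k j k j+k≡1+n s≤n) ⟨
    suc (emptySpots (s ∷ occ) j k) ∎)
    where
    -- When a < j, the spots a, …, j − 1 are full, so the window may be widened back to a.
    carCounted : suc (count (j ≤?_) α) ≤ emptySpots occ j k
    carCounted with j ≤? a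
    ... | yes j≤a = subst (_≤ emptySpots occ j k) (count-accept (j ≤?_) α j≤a) (feasible j k j+k≡1+n)
    ... | no j≰a with m≤n⇒∃[o]m+o≡n (<⇒≤ (≰⇒> j≰a))
    ...   | d , refl = begin
      suc (count (a + d ≤?_) α)  ≤⟨ s≤s (count-≤?-antitone α (m≤m+n a d)) ⟩
      suc (count (a ≤?_) α)      ≡⟨ count-accept (a ≤?_) α ≤-refl ⟨
      count (a ≤?_) (a ∷ α)      ≤⟨ feasible a (d + k) (trans (sym (+-assoc a d k)) j+k≡1+n) ⟩
      emptySpots occ a (d + k)   ≡⟨ emptySpots-skipFull occ a d k (Full-shrinkʳ occ j≤s full) ⟩
      emptySpots occ (a + d) k   ∎

  Feasible-unpark : ∀ {m occ a s} {α : Vec ℕ m} → a ≤ s → s ≤ n → occupied occ s ≡ false →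
                    Feasible (s ∷ occ) α → Feasible occ (a ∷ α)
  Feasible-unpark {occ = occ} {a} {s} {α} a≤s s≤n free feasible j k j+k≡1+n with j ≤? a
  ... | yes j≤a = begin
    count (j ≤?_) (a ∷ α)          ≡⟨ count-accept (j ≤?_) α j≤a ⟩
    suc (count (j ≤?_) α)          ≤⟨ s≤s (feasible j k j+k≡1+n) ⟩
    suc (emptySpots (s ∷ occ) j k)
      ≡⟨ emptySpots-park-free occ j k free (≤-trans j≤a a≤s) (s<j+k j k j+k≡1+n s≤n) ⟩
    emptySpots occ j k             ∎
  ... | no j≰a = begin
    count (j ≤?_) (a ∷ α)    ≡⟨ count-reject (j ≤?_) α j≰a ⟩
    count (j ≤?_) α          ≤⟨ feasible j k j+k≡1+n ⟩
    emptySpots (s ∷ occ) j k ≤⟨ emptySpots-park-≤ occ j k ⟩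
    emptySpots occ j k       ∎

  stepNaples-parks : ∀ {m occ a} {α : Vec ℕ m} → Feasible occ (a ∷ α) → a ≤ n → ∀ b →
    ∃[ s ] stepNaples n occ a b ≡ just (s ∷ occ) × ValidSpot occ a s
  stepNaples-parks {occ = occ} {a} {α} feasible a≤n b with occupied occ a in occ-a
  ... | false = a , refl , occ-a , a≤n , Full-empty occ ≤-refl
  ... | true with b ∧ (1 <ᵇ a) ∧ not (occupied occ (a ∸ 1)) in back
  ...   | true =
    a ∸ 1 , refl , ∧-not≡true b _ _ back , ≤-trans (m∸n≤m a 1) a≤n , Full-empty occ (m∸n≤m a 1)
  ...   | false with parkForward n occ a in forward
  ...     | nothing =
    ⊥-elim (Feasible⇒¬Full {α = α} feasible a≤n (Full-extendˡ occ occ-a (parkForward-nothing a≤n forward)))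
  ...     | just _ with parkForward-just a≤n forward
  ...       | s , refl , _ , s≤n , free , full = s , refl , free , s≤n , Full-extendˡ occ occ-a full

  runNaples-parks : ∀ {m occ} {α : Vec ℕ m} → Feasible occ α → All (InRange n) α →
                    ∀ c → is-just (runNaples n occ α c) ≡ true
  runNaples-parks {α = []}    _        []                  []      = refl
  runNaples-parks {α = _ ∷ α} feasible ((_ , a≤n) ∷ inRange) (b ∷ c)
    with stepNaples-parks {α = α} feasible a≤n b
  ... | _ , step , valid rewrite step = runNaples-parks (Feasible-park {α = α} valid feasible) inRange c

  runPF-feasible : ∀ {m occ} {α : Vec ℕ m} → All (InRange n) α →
                   is-just (runPF n occ α) ≡ true → Feasible occ α
  runPF-feasible {α = []} [] _ _ _ _ = z≤n
  runPF-feasible {occ = occ} {a ∷ α} ((_ , a≤n) ∷ inRange) parks with stepPF n occ a in step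
  ... | just _ with stepPF-just a≤n step
  ...   | _ , refl , a≤s , s≤n , free =
    Feasible-unpark {α = α} a≤s s≤n free (runPF-feasible inRange parks)

  -- With coin false, stepNaples is stepPF definitionally.
  runNaples-allFalse : ∀ {m} occ (α : Vec ℕ m) → runNaples n occ α (replicate m false) ≡ runPF n occ α
  runNaples-allFalse occ []      = refl
  runNaples-allFalse occ (a ∷ α) with stepPF n occ a
  ... | nothing   = refl
  ... | just occ' = runNaples-allFalse occ' α

theorem7 : (n : ℕ) → 1 ≤ n → (α : Vec ℕ n) → All (InRange n) α →
    IsParkingFunction α ⇔ (probParks ½ α ≡ 1ℚ)
theorem7 n _ α inRange = mk⇔ parksSurely parksClassically
  where
  parks : Vec Bool n → Bool
  parks c = is-just (runNaples n [] α c)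

  total : mass (coinWeight ½) (allCoins n) ≡ 1ℚ
  total = mass-allCoins ½ n

  parksSurely : IsParkingFunction α → probParks ½ α ≡ 1ℚ
  parksSurely pf = trans (massOf-all (coinWeight ½) parks (allCoins n) parksAlways) total
    where
    parksAlways : ∀ c → parks c ≡ true
    parksAlways = runNaples-parks n (runPF-feasible n inRange pf) inRange

  parksClassically : probParks ½ α ≡ 1ℚ → IsParkingFunction α
  parksClassically surely = trans (cong is-just (sym (runNaples-allFalse n [] α))) parksAllFalse
    where
    parksAllFalse : parks (replicate n false) ≡ true
    parksAllFalse = massOf≡mass⇒true (coinWeight ½) (coinWeight-pos 0<½ ½<1) parks (allCoins n)
                      (trans surely (sym total)) (allCoins-complete (replicate n false))
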